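{- For every $k\in\mathcal K$, the map $S\to\mathbb Z$, $s\mapsto d^{\mathrm{ur},\dagger}_k(s)$, is odd dominant.
   Context: Let $p\ge7$ be prime, $k_0\in\{2,\dots,p\}$, $\mathcal K=\{k\ge2:k\equiv k_0\pmod{p-1}\}$, $k_\bullet=(k-k_0)/(p-1)$, $\{n\}\in\{0,\dots,p-2\}$ the residue mod $p-1$. For $s\in\{0,\dots,p-2\}$: $a_s=\{k_0-2-2s\}$; $\delta_s=0$ if $s+\{a_s+s\}<p-1$, else $1$; if $a_s+s<p-1$, $t_1^{(s)}=s+\delta_s$, $t_2^{(s)}=a_s+s+\delta_s+2$; otherwise $t_1^{(s)}=\{a_s+s\}+\delta_s+1$, $t_2^{(s)}=s+\delta_s+1$. $d^{\mathrm{ur},\dagger}_k(s)=\lfloor\frac{k_\bullet-t_1^{(s)}}{p+1}\rfloor+\lfloor\frac{k_\bullet-t_2^{(s)}}{p+1}\rfloor+2+\delta_s$. $S=\{\lceil\frac{k_0+1}2\rceil,\dots,\lfloor\frac{k_0-4+p}2\rfloor\}$. For $\phi:S\to\mathbb Z$, a pair $s<s'$ in $S$ is $\phi$-regular if $|\phi(s)-\phi(s')|\le1$ and, whenever $\phi(s)\ne\phi(s')$, $\phi(s')$ is odd; $\phi$ is odd dominant if every pair $s<s'$ in $S$ is $\phi$-regular. -}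

module Defs where

open import Data.Bool using (if_then_else_)
open import Data.Nat as ℕ using (ℕ; suc; _∸_; _<ᵇ_)
open import Data.Integer as ℤ using (ℤ; +_; _-_; _/ℕ_; _%ℕ_; ∣_∣)
open import Data.Integer.Divisibility using () renaming (_∣_ to _∣ℤ_)
open import Data.Product using (_×_)
open import Relation.Binary.PropositionalEquality using (_≡_; _≢_)
open import Relation.Nullary using (¬_)

-- p - 1, written as a successor so that it is syntactically nonzero
-- (for p ≥ 2, suc (p ∸ 2) = p - 1)
pm1 : ℕ → ℕ
pm1 p = suc (p ∸ 2)

res : (p : ℕ) → ℤ → ℕ
res p n = n %ℕ pm1 p

-- k_• = (k - k₀)/(p - 1)  (exact division under the hypotheses)
kbul : (p k₀ k : ℕ) → ℤ
kbul p k₀ k = (+ k - + k₀) /ℕ pm1 p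

a : (p k₀ s : ℕ) → ℕ
a p k₀ s = res p (+ k₀ - + 2 - + (2 ℕ.* s))

δ : (p k₀ s : ℕ) → ℕ
δ p k₀ s = if (s ℕ.+ res p (+ (a p k₀ s ℕ.+ s))) <ᵇ pm1 p then 0 else 1

t₁ : (p k₀ s : ℕ) → ℕ
t₁ p k₀ s =
  if (a p k₀ s ℕ.+ s) <ᵇ pm1 p
  then s ℕ.+ δ p k₀ s
  else res p (+ (a p k₀ s ℕ.+ s)) ℕ.+ δ p k₀ s ℕ.+ 1

t₂ : (p k₀ s : ℕ) → ℕ
t₂ p k₀ s =
  if (a p k₀ s ℕ.+ s) <ᵇ pm1 p
  then a p k₀ s ℕ.+ s ℕ.+ δ p k₀ s ℕ.+ 2
  else s ℕ.+ δ p k₀ s ℕ.+ 1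

-- d^{ur,†}_k(s); _/ℕ_ on ℤ with positive divisor is floor division
dUrDagger : (p k₀ k s : ℕ) → ℤ
dUrDagger p k₀ k s =
  ((kbul p k₀ k - + t₁ p k₀ s) /ℕ suc p)
  ℤ.+ ((kbul p k₀ k - + t₂ p k₀ s) /ℕ suc p)
  ℤ.+ + 2 ℤ.+ + δ p k₀ s

-- S = {⌈(k₀+1)/2⌉, …, ⌊(k₀-4+p)/2⌋}
-- ⌈(k₀+1)/2⌉ = ⌊(k₀+2)/2⌋; and k₀ - 4 + p ≥ 0 since p ≥ 7
InS : (p k₀ s : ℕ) → Set
InS p k₀ s = ((k₀ ℕ.+ 2) ℕ./ 2 ℕ.≤ s) × (s ℕ.≤ (k₀ ℕ.+ p ∸ 4) ℕ./ 2)

OddInt : ℤ → Set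
OddInt x = ¬ (+ 2 ∣ℤ x)

Regular : (φ : ℕ → ℤ) → ℕ → ℕ → Set
Regular φ s s' = (∣ φ s - φ s' ∣ ℕ.≤ 1) × (φ s ≢ φ s' → OddInt (φ s'))

OddDominant : (Sp : ℕ → Set) → (ℕ → ℤ) → Set
OddDominant Sp φ = ∀ s s' → Sp s → Sp s' → s ℕ.< s' → Regular φ s s'

{-# OPTIONS --safe #-}
module Submission where

-- On S we have k₀ + 1 ≤ 2s ≤ k₀ + p - 4, hence a_s = k₀ + p - 3 - 2s, and the case distinctions
-- in t₁, t₂, δ are all decided by whether s ≤ k₀ - 2 (δ_s = 0) or s > k₀ - 2 (δ_s = 1).  Writing
-- F x = ⌊x / (p + 1)⌋, both cases give
--   d(s) = F (k_• - s - 1) + F (k_• - k₀ + 1 + s) + 2,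
-- the shift of t₂ by p + 1 when δ_s = 1 being absorbed by F (x + p + 1) = F x + 1.
-- For s < s' in S the arguments k_• - s' - 1 ≤ k_• - s - 1 ≤ k_• - k₀ + 1 + s ≤ k_• - k₀ + 1 + s'
-- span less than p + 1, so their floors satisfy a ≤ b ≤ c ≤ e ≤ a + 1, while d(s) = b + c + 2 and
-- d(s') = a + e + 2: either all four are equal, or d(s') = 2a + 3 is odd and d(s) is within 1 of it.

open import Data.Bool.Base using (true; false)
open import Data.Bool.Properties using (T-≡)
open import Data.List.Base using (_∷_; [])
open import Data.Product.Base using (_×_; _,_; proj₁; proj₂)
open import Data.Sum.Base using (_⊎_; inj₁; inj₂; [_,_]′)
open import Function.Base using (_∘_)
open import Function.Bundles using (Equivalence)
open import Relation.Binary.PropositionalEquality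
open import Relation.Nullary.Decidable using (yes; no)
open import Relation.Nullary.Negation using (contradiction)
open import Relation.Nullary.Reflects using (ofʸ)

open import Defs

module _ where
  open import Data.Nat.Base
  open import Data.Nat.Properties
  open import Data.Nat.DivMod using (_/_; m*n/n≡m; /-monoˡ-≤; m/n*n≤m)
  open import Data.Nat.Tactic.RingSolver using (solve)
  open import Data.Integer.Base using (+_)

  <ᵇ-true : ∀ {m n} → m < n → (m <ᵇ n) ≡ true
  <ᵇ-true m<n = Equivalence.to T-≡ (<⇒<ᵇ m<n)

  <ᵇ-false : ∀ {m n} → n ≤ m → (m <ᵇ n) ≡ false
  <ᵇ-false {m} {n} n≤m with m <ᵇ n | <ᵇ-reflects-< m n
  ... | false | _       = refl
  ... | true  | ofʸ m<n = contradiction m<n (≤⇒≯ n≤m)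

  module _ (p k₀ s : ℕ) where

    δ≡0 : s + res p (+ (a p k₀ s + s)) < pm1 p → δ p k₀ s ≡ 0
    δ≡0 h rewrite <ᵇ-true h = refl

    δ≡1 : pm1 p ≤ s + res p (+ (a p k₀ s + s)) → δ p k₀ s ≡ 1
    δ≡1 h rewrite <ᵇ-false h = refl

    t₁-a+s<p-1 : a p k₀ s + s < pm1 p → t₁ p k₀ s ≡ s + δ p k₀ s
    t₁-a+s<p-1 h rewrite <ᵇ-true h = refl

    t₁-p-1≤a+s : pm1 p ≤ a p k₀ s + s →
                 t₁ p k₀ s ≡ res p (+ (a p k₀ s + s)) + δ p k₀ s + 1
    t₁-p-1≤a+s h rewrite <ᵇ-false h = refl

    t₂-a+s<p-1 : a p k₀ s + s < pm1 p → t₂ p k₀ s ≡ a p k₀ s + s + δ p k₀ s + 2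
    t₂-a+s<p-1 h rewrite <ᵇ-true h = refl

    t₂-p-1≤a+s : pm1 p ≤ a p k₀ s + s → t₂ p k₀ s ≡ s + δ p k₀ s + 1
    t₂-p-1≤a+s h rewrite <ᵇ-false h = refl

  [n+2]/2≤s⇒n<s+s : ∀ n s → (n + 2) / 2 ≤ s → n < s + s
  [n+2]/2≤s⇒n<s+s n s h = ≰⇒> λ s+s≤n → n≮n s (begin-strict
    s                 <⟨ n<1+n s ⟩
    suc s             ≡⟨ m*n/n≡m (suc s) 2 ⟨
    suc s * 2 / 2     ≤⟨ /-monoˡ-≤ 2 (begin
      suc s * 2         ≡⟨ solve (s ∷ []) ⟩
      s + s + 2         ≤⟨ +-monoˡ-≤ 2 s+s≤n ⟩
      n + 2             ∎) ⟩
    (n + 2) / 2       ≤⟨ h ⟩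
    s                 ∎)
    where open ≤-Reasoning

  s≤n/2⇒s+s≤n : ∀ n s → s ≤ n / 2 → s + s ≤ n
  s≤n/2⇒s+s≤n n s h = begin
    s + s             ≡⟨ solve (s ∷ []) ⟩
    s * 2             ≤⟨ *-monoˡ-≤ 2 h ⟩
    n / 2 * 2         ≤⟨ m/n*n≤m n 2 ⟩
    n                 ∎
    where open ≤-Reasoning

  InS-bounds : ∀ P K0 {s} → InS (suc (suc P)) (suc (suc K0)) s → K0 < s + s × s + s ≤ K0 + P
  InS-bounds P K0 {s} (lo , hi) =
    <-trans (n<1+n K0) (<-trans (n<1+n (suc K0)) ([n+2]/2≤s⇒n<s+s (suc (suc K0)) s lo)) ,
    s≤n/2⇒s+s≤n (K0 + P) s (subst (λ n → s ≤ n / 2) (cong (_∸ 2) K0+[2+P]≡2+[K0+P]) hi)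
    where
    K0+[2+P]≡2+[K0+P] : K0 + suc (suc P) ≡ suc (suc (K0 + P))
    K0+[2+P]≡2+[K0+P] = trans (+-suc K0 (suc P)) (cong suc (+-suc K0 P))

  module _ {P K0 : ℕ} (s A : ℕ) (A+2s≡ : A + (s + s) ≡ suc (K0 + P)) where

    A+s<p-1 : K0 < s → A + s < suc P
    A+s<p-1 K0<s = s≤s (+-cancelʳ-≤ (suc K0) (A + s) P (begin
      A + s + suc K0       ≤⟨ +-monoʳ-≤ (A + s) K0<s ⟩
      A + s + s            ≡⟨ +-assoc A s s ⟩
      A + (s + s)          ≡⟨ A+2s≡ ⟩
      suc (K0 + P)         ≡⟨ solve (K0 ∷ P ∷ []) ⟩
      P + suc K0           ∎))
      where open ≤-Reasoning

    p-1≤s+[A+s] : suc P ≤ s + (A + s)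
    p-1≤s+[A+s] = begin
      suc P                ≤⟨ s≤s (m≤n+m P K0) ⟩
      suc (K0 + P)         ≡⟨ A+2s≡ ⟨
      A + (s + s)          ≡⟨ solve (A ∷ s ∷ []) ⟩
      s + (A + s)          ∎
      where open ≤-Reasoning

    k₀-1+[p+1]≡[A+s+3]+s : suc K0 + suc (suc (suc P)) ≡ A + s + 1 + 2 + s
    k₀-1+[p+1]≡[A+s+3]+s = begin
      suc K0 + suc (suc (suc P))  ≡⟨ solve (K0 ∷ P ∷ []) ⟩
      suc (K0 + P) + 3            ≡⟨ cong (_+ 3) A+2s≡ ⟨
      A + (s + s) + 3             ≡⟨ solve (A ∷ s ∷ []) ⟩
      A + s + 1 + 2 + s           ∎
      where open ≡-Reasoning

    A+s≡r+[p-1] : ∀ {r} → s + r ≡ K0 → A + s ≡ r + suc P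
    A+s≡r+[p-1] {r} s+r≡K0 = +-cancelʳ-≡ s (A + s) (r + suc P) (begin
      A + s + s            ≡⟨ +-assoc A s s ⟩
      A + (s + s)          ≡⟨ A+2s≡ ⟩
      suc (K0 + P)         ≡⟨ cong (λ x → suc (x + P)) s+r≡K0 ⟨
      suc (s + r + P)      ≡⟨ solve (s ∷ r ∷ P ∷ []) ⟩
      r + suc P + s        ∎)
      where open ≡-Reasoning

module _ where
  open import Data.Nat.Base as ℕ using (ℕ)
  import Data.Nat.Properties as ℕ
  open import Data.Nat.DivMod using (m<n⇒m%n≡m; [m+n]%n≡m%n)
  open import Data.Nat.Tactic.RingSolver using () renaming (solve to solveℕ)
  open import Data.Integer.Base
  open import Data.Integer.Properties
  open import Data.Integer.DivMod using (a≡a%ℕn+[a/ℕn]*n; [n/ℕd]*d≤n; n<s[n/ℕd]*d)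
  open import Data.Integer.Divisibility.Signed using (divides; ∣ᵤ⇒∣)
  open import Data.Integer.Tactic.RingSolver using (solve-∀)
  open import Algebra.Properties.AbelianGroup +-0-abelianGroup using (∙-cancelʳ)

  module _ (m : ℕ) .{{_ : ℕ.NonZero m}} where

    quotient-≤ : ∀ {q q' x} → q * + m ≤ x → x < suc q' * + m → q ≤ q'
    quotient-≤ {q} {q'} lo hi = subst (q ≤_) (pred-suc q')
      (i<j⇒i≤pred[j] {q} {suc q'} (*-cancelʳ-<-nonNeg {q} {suc q'} (+ m) (≤-<-trans lo hi)))

    /ℕ-unique : ∀ {q x} → q * + m ≤ x → x < suc q * + m → x /ℕ m ≡ q
    /ℕ-unique {x = x} lo hi =
      ≤-antisym (quotient-≤ ([n/ℕd]*d≤n x m) hi) (quotient-≤ lo (n<s[n/ℕd]*d x m))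

    /ℕ-monoˡ-≤ : ∀ {x y} → x ≤ y → x /ℕ m ≤ y /ℕ m
    /ℕ-monoˡ-≤ {x} {y} x≤y = quotient-≤ (≤-trans ([n/ℕd]*d≤n x m) x≤y) (n<s[n/ℕd]*d y m)

    /ℕ-≤-suc : ∀ {x y} → y < x + + m → y /ℕ m ≤ suc (x /ℕ m)
    /ℕ-≤-suc {x} {y} y<x+m = quotient-≤ ([n/ℕd]*d≤n y m) (begin-strict
      y                          <⟨ y<x+m ⟩
      x + + m                    <⟨ +-monoˡ-< (+ m) (n<s[n/ℕd]*d x m) ⟩
      suc (x /ℕ m) * + m + + m   ≡⟨ +-comm (suc (x /ℕ m) * + m) (+ m) ⟩
      + m + suc (x /ℕ m) * + m   ≡⟨ suc-* (suc (x /ℕ m)) (+ m) ⟨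
      suc (suc (x /ℕ m)) * + m   ∎)
      where open ≤-Reasoning

    [x+m]/ℕm≡suc[x/ℕm] : ∀ x → (x + + m) /ℕ m ≡ suc (x /ℕ m)
    [x+m]/ℕm≡suc[x/ℕm] x = /ℕ-unique
      (begin
        suc (x /ℕ m) * + m         ≡⟨ suc-* (x /ℕ m) (+ m) ⟩
        + m + x /ℕ m * + m         ≤⟨ +-monoʳ-≤ (+ m) ([n/ℕd]*d≤n x m) ⟩
        + m + x                    ≡⟨ +-comm (+ m) x ⟩
        x + + m                    ∎)
      (begin-strict
        x + + m                    <⟨ +-monoˡ-< (+ m) (n<s[n/ℕd]*d x m) ⟩
        suc (x /ℕ m) * + m + + m   ≡⟨ +-comm (suc (x /ℕ m) * + m) (+ m) ⟩
        + m + suc (x /ℕ m) * + m   ≡⟨ suc-* (suc (x /ℕ m)) (+ m) ⟨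
        suc (suc (x /ℕ m)) * + m   ∎)
      where open ≤-Reasoning

    [r+qm]/ℕm≡q : ∀ {q r} → r ℕ.< m → (+ r + q * + m) /ℕ m ≡ q
    [r+qm]/ℕm≡q {q} {r} r<m = /ℕ-unique (i≤j+i (q * + m) (+ r)) (begin-strict
      + r + q * + m              <⟨ +-monoˡ-< (q * + m) (+<+ r<m) ⟩
      + m + q * + m              ≡⟨ suc-* q (+ m) ⟨
      suc q * + m                ∎)
      where open ≤-Reasoning

    %ℕ-unique : ∀ {x q r} → x ≡ + r + q * + m → r ℕ.< m → x %ℕ m ≡ r
    %ℕ-unique {x} {q} {r} refl r<m = +-injective (∙-cancelʳ (q * + m) _ _ (begin
      + (x %ℕ m) + q * + m          ≡⟨ cong (λ t → + (x %ℕ m) + t * + m) ([r+qm]/ℕm≡q {q} r<m) ⟨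
      + (x %ℕ m) + x /ℕ m * + m     ≡⟨ a≡a%ℕn+[a/ℕn]*n x m ⟨
      x                             ∎))
      where open ≡-Reasoning

  odd-2i+1 : ∀ i → OddInt (i * + 2 + + 1)
  odd-2i+1 i 2∣x with ∣ᵤ⇒∣ {+ 2} {i * + 2 + + 1} 2∣x
  ... | divides q x≡q*2 = contradiction (trans (sym x%2≡0) x%2≡1) λ ()
    where
    x%2≡0 : (i * + 2 + + 1) %ℕ 2 ≡ 0
    x%2≡0 = %ℕ-unique 2 {q = q} (trans x≡q*2 (sym (+-identityˡ (q * + 2)))) (ℕ.s≤s ℕ.z≤n)
    x%2≡1 : (i * + 2 + + 1) %ℕ 2 ≡ 1
    x%2≡1 = %ℕ-unique 2 {q = i} (+-comm (i * + 2) (+ 1)) (ℕ.s≤s (ℕ.s≤s ℕ.z≤n))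

  RegularPair : ℤ → ℤ → Set
  RegularPair x y = ∣ x - y ∣ ℕ.≤ 1 × (x ≢ y → OddInt y)

  regular-refl : ∀ x → RegularPair x x
  regular-refl x rewrite +-inverseʳ x = ℕ.z≤n , λ x≢x → contradiction refl x≢x

  regular-odd : ∀ {x y} → OddInt y → ∣ x - y ∣ ℕ.≤ 1 → RegularPair x y
  regular-odd odd close = close , λ _ → odd

  ≤-suc-cases : ∀ {i j} → i ≤ j → j ≤ suc i → j ≡ i ⊎ j ≡ suc i
  ≤-suc-cases {i} {j} i≤j j≤1+i with j ≟ i
  ... | yes j≡i = inj₁ j≡i
  ... | no j≢i  = inj₂ (≤-antisym j≤1+i (i<j⇒suc[i]≤j (≤∧≢⇒< i≤j (j≢i ∘ sym))))

  sandwich-regular : ∀ {a b c e} → a ≤ b → b ≤ c → c ≤ e → e ≤ suc a →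
                     RegularPair (b + c + + 2) (a + e + + 2)
  sandwich-regular {a} {b} {c} a≤b b≤c c≤e e≤1+a
    with ≤-suc-cases (≤-trans a≤b (≤-trans b≤c c≤e)) e≤1+a
  ... | inj₁ refl = subst (RegularPair (b + c + + 2))
    (cong₂ (λ u v → u + v + + 2) (≤-antisym (≤-trans b≤c c≤e) a≤b)
                                 (≤-antisym c≤e (≤-trans a≤b b≤c)))
    (regular-refl (b + c + + 2))
  ... | inj₂ refl =
    regular-odd (subst OddInt (sym (2a+3≡2[a+1]+1 a)) (odd-2i+1 (a + + 1))) (close a≤b b≤c c≤e)
    where
    2a+3≡2[a+1]+1 : ∀ a → a + (+ 1 + a) + + 2 ≡ (a + + 1) * + 2 + + 1
    2a+3≡2[a+1]+1 = solve-∀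
    close : ∀ {a b c} → a ≤ b → b ≤ c → c ≤ suc a →
            ∣ (b + c + + 2) - (a + suc a + + 2) ∣ ℕ.≤ 1
    close {a} a≤b b≤c c≤1+a with ≤-suc-cases (≤-trans a≤b b≤c) c≤1+a
    ... | inj₁ refl rewrite ≤-antisym b≤c a≤b =
      subst (λ d → ∣ d ∣ ℕ.≤ 1) (sym (d≡-1 a)) (ℕ.s≤s ℕ.z≤n)
      where d≡-1 : ∀ a → a + a + + 2 - (a + (+ 1 + a) + + 2) ≡ - + 1
            d≡-1 = solve-∀
    ... | inj₂ refl with ≤-suc-cases a≤b (≤-trans b≤c c≤1+a)
    ...   | inj₁ refl = subst (λ d → ∣ d ∣ ℕ.≤ 1) (sym (+-inverseʳ (a + suc a + + 2))) ℕ.z≤n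
    ...   | inj₂ refl = subst (λ d → ∣ d ∣ ℕ.≤ 1) (sym (d≡1 a)) (ℕ.s≤s ℕ.z≤n)
      where d≡1 : ∀ a → (+ 1 + a) + (+ 1 + a) + + 2 - (a + (+ 1 + a) + + 2) ≡ + 1
            d≡1 = solve-∀

  +a-+b≡+c-+d : ∀ a b c d → a ℕ.+ d ≡ c ℕ.+ b → + a - + b ≡ + c - + d
  +a-+b≡+c-+d a b c d a+d≡c+b = begin
    + a - + b                  ≡⟨ [+m]-[+n]≡m⊖n a b ⟩
    a ⊖ b                      ≡⟨ +-cancelˡ-⊖ d a b ⟨
    (d ℕ.+ a) ⊖ (d ℕ.+ b)      ≡⟨ cong₂ _⊖_ d+a≡b+c (ℕ.+-comm d b) ⟩
    (b ℕ.+ c) ⊖ (b ℕ.+ d)      ≡⟨ +-cancelˡ-⊖ b c d ⟩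
    c ⊖ d                      ≡⟨ [+m]-[+n]≡m⊖n c d ⟨
    + c - + d                  ∎
    where
    open ≡-Reasoning
    d+a≡b+c : d ℕ.+ a ≡ b ℕ.+ c
    d+a≡b+c = trans (ℕ.+-comm d a) (trans a+d≡c+b (ℕ.+-comm c b))

  [k-a]+b≡[k-c]+d : ∀ k {a b c d} → a ℕ.+ d ≡ c ℕ.+ b → k - + a + + b ≡ k - + c + + d
  [k-a]+b≡[k-c]+d k {a} {b} {c} {d} a+d≡c+b = begin
    k - + a + + b              ≡⟨ regroup k (+ a) (+ b) ⟩
    k + (+ b - + a)            ≡⟨ cong (_+_ k) (+a-+b≡+c-+d b a d c b+c≡d+a) ⟩
    k + (+ d - + c)            ≡⟨ regroup k (+ c) (+ d) ⟨
    k - + c + + d              ∎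
    where
    open ≡-Reasoning
    regroup : ∀ k x y → k - x + y ≡ k + (y - x)
    regroup = solve-∀
    b+c≡d+a : b ℕ.+ c ≡ d ℕ.+ a
    b+c≡d+a = trans (ℕ.+-comm b c) (trans (sym a+d≡c+b) (ℕ.+-comm a d))

  k-a≡[k-c]+d : ∀ k {a c d} → a ℕ.+ d ≡ c → k - + a ≡ k - + c + + d
  k-a≡[k-c]+d k {a} {c} a+d≡c = trans (sym (+-identityʳ (k - + a)))
    ([k-a]+b≡[k-c]+d k (trans a+d≡c (sym (ℕ.+-identityʳ c))))

  floor-sandwich-regular : ∀ m .{{_ : ℕ.NonZero m}} B {i j l n} →
    i ℕ.≤ j → j ℕ.≤ l → l ℕ.≤ n → n ℕ.< i ℕ.+ m →
    RegularPair ((B + + j) /ℕ m + (B + + l) /ℕ m + + 2) ((B + + i) /ℕ m + (B + + n) /ℕ m + + 2)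
  floor-sandwich-regular m B {i} {n = n} i≤j j≤l l≤n n<i+m =
    sandwich-regular (mono i≤j) (mono j≤l) (mono l≤n) (/ℕ-≤-suc m {B + + i} (begin-strict
      B + + n             <⟨ +-monoʳ-< B (+<+ n<i+m) ⟩
      B + + (i ℕ.+ m)     ≡⟨ cong (_+_ B) (pos-+ i m) ⟩
      B + (+ i + + m)     ≡⟨ +-assoc B (+ i) (+ m) ⟨
      B + + i + + m       ∎))
    where
    open ≤-Reasoning
    mono : ∀ {i j} → i ℕ.≤ j → (B + + i) /ℕ m ≤ (B + + j) /ℕ m
    mono i≤j = /ℕ-monoˡ-≤ m (+-monoʳ-≤ B (+≤+ i≤j))

  dClosedForm : (m : ℕ) .{{_ : ℕ.NonZero m}} → ℤ → ℕ → ℕ → ℤ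
  dClosedForm m K c s = (K - + (s ℕ.+ 1)) /ℕ m + (K - + c + + s) /ℕ m + + 2

  dClosedForm-regular : ∀ m .{{_ : ℕ.NonZero m}} K c {s s'} →
    s ℕ.≤ s' → c ℕ.≤ ℕ.suc (s ℕ.+ s) → ℕ.suc (s' ℕ.+ s') ℕ.< c ℕ.+ m →
    RegularPair (dClosedForm m K c s) (dClosedForm m K c s')
  dClosedForm-regular m K c {s} {s'} s≤s' c≤2s+1 2s'+1<c+m =
    subst₂ RegularPair (cong₂ F+F+2 (sym x₂≡) (sym x₃≡)) (cong₂ F+F+2 (sym x₁≡) (sym x₄≡))
      (floor-sandwich-regular m (K - + (c ℕ.+ (s ℕ.+ s') ℕ.+ 1))
        o₁≤o₂ o₂≤o₃ o₃≤o₄ o₄<o₁+m)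
    where
    F+F+2 : ℤ → ℤ → ℤ
    F+F+2 x y = x /ℕ m + y /ℕ m + + 2
    x₁≡ : K - + (s' ℕ.+ 1) ≡ K - + (c ℕ.+ (s ℕ.+ s') ℕ.+ 1) + + (c ℕ.+ s)
    x₁≡ = k-a≡[k-c]+d K (solveℕ (s ∷ s' ∷ c ∷ []))
    x₂≡ : K - + (s ℕ.+ 1) ≡ K - + (c ℕ.+ (s ℕ.+ s') ℕ.+ 1) + + (c ℕ.+ s')
    x₂≡ = k-a≡[k-c]+d K (solveℕ (s ∷ s' ∷ c ∷ []))
    x₃≡ : K - + c + + s ≡ K - + (c ℕ.+ (s ℕ.+ s') ℕ.+ 1) + + (s ℕ.+ s' ℕ.+ s ℕ.+ 1)
    x₃≡ = [k-a]+b≡[k-c]+d K (solveℕ (s ∷ s' ∷ c ∷ []))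
    x₄≡ : K - + c + + s' ≡ K - + (c ℕ.+ (s ℕ.+ s') ℕ.+ 1) + + (s ℕ.+ s' ℕ.+ s' ℕ.+ 1)
    x₄≡ = [k-a]+b≡[k-c]+d K (solveℕ (s ∷ s' ∷ c ∷ []))
    o₁≤o₂ : c ℕ.+ s ℕ.≤ c ℕ.+ s'
    o₁≤o₂ = ℕ.+-monoʳ-≤ c s≤s'
    o₂≤o₃ : c ℕ.+ s' ℕ.≤ s ℕ.+ s' ℕ.+ s ℕ.+ 1
    o₂≤o₃ = begin
      c ℕ.+ s'                    ≤⟨ ℕ.+-monoˡ-≤ s' c≤2s+1 ⟩
      ℕ.suc (s ℕ.+ s) ℕ.+ s'      ≡⟨ solveℕ (s ∷ s' ∷ []) ⟩
      s ℕ.+ s' ℕ.+ s ℕ.+ 1        ∎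
      where open ℕ.≤-Reasoning
    o₃≤o₄ : s ℕ.+ s' ℕ.+ s ℕ.+ 1 ℕ.≤ s ℕ.+ s' ℕ.+ s' ℕ.+ 1
    o₃≤o₄ = ℕ.+-monoˡ-≤ 1 (ℕ.+-monoʳ-≤ (s ℕ.+ s') s≤s')
    o₄<o₁+m : s ℕ.+ s' ℕ.+ s' ℕ.+ 1 ℕ.< c ℕ.+ s ℕ.+ m
    o₄<o₁+m = begin-strict
      s ℕ.+ s' ℕ.+ s' ℕ.+ 1       ≡⟨ solveℕ (s ∷ s' ∷ []) ⟩
      s ℕ.+ ℕ.suc (s' ℕ.+ s')     <⟨ ℕ.+-monoʳ-< s 2s'+1<c+m ⟩
      s ℕ.+ (c ℕ.+ m)             ≡⟨ solveℕ (s ∷ c ∷ m ∷ []) ⟩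
      c ℕ.+ s ℕ.+ m               ∎
      where open ℕ.≤-Reasoning

  dUrDagger-≡ : ∀ p k₀ k s {u v e} →
    t₁ p k₀ s ≡ u → t₂ p k₀ s ≡ v → δ p k₀ s ≡ e →
    dUrDagger p k₀ k s ≡
      (kbul p k₀ k - + u) /ℕ ℕ.suc p + (kbul p k₀ k - + v) /ℕ ℕ.suc p + + 2 + + e
  dUrDagger-≡ p k₀ k s refl refl refl = refl

  module _ (P K0 k : ℕ) where

    private
      p k₀ : ℕ
      p = ℕ.suc (ℕ.suc P)
      k₀ = ℕ.suc (ℕ.suc K0)
      K : ℤ
      K = kbul p k₀ k
      F : ℤ → ℤ
      F x = x /ℕ ℕ.suc p

    a+2s≡k₀+p-3 : ∀ {s} → K0 ℕ.< s ℕ.+ s → s ℕ.+ s ℕ.≤ ℕ.suc (K0 ℕ.+ P) →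
                  a p k₀ s ℕ.+ (s ℕ.+ s) ≡ ℕ.suc (K0 ℕ.+ P)
    a+2s≡k₀+p-3 {s} K0<2s 2s≤n = begin
      a p k₀ s ℕ.+ (s ℕ.+ s)   ≡⟨ cong (ℕ._+ (s ℕ.+ s)) a≡A ⟩
      A ℕ.+ (s ℕ.+ s)          ≡⟨ ℕ.+-comm A (s ℕ.+ s) ⟩
      s ℕ.+ s ℕ.+ A            ≡⟨ ℕ.m+[n∸m]≡n 2s≤n ⟩
      ℕ.suc (K0 ℕ.+ P)         ∎
      where
      open ≡-Reasoning
      A : ℕ
      A = ℕ.suc (K0 ℕ.+ P) ℕ.∸ (s ℕ.+ s)
      A<p-1 : A ℕ.< ℕ.suc P
      A<p-1 = ℕ.s≤s (ℕ.≤-trans (ℕ.∸-monoʳ-≤ (ℕ.suc (K0 ℕ.+ P)) K0<2s)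
                               (ℕ.≤-reflexive (ℕ.m+n∸m≡n (ℕ.suc K0) P)))
      K0+[p-1]≡A+2s : K0 ℕ.+ ℕ.suc P ≡ A ℕ.+ 2 ℕ.* s
      K0+[p-1]≡A+2s = begin
        K0 ℕ.+ ℕ.suc P         ≡⟨ ℕ.+-suc K0 P ⟩
        ℕ.suc (K0 ℕ.+ P)       ≡⟨ ℕ.m+[n∸m]≡n 2s≤n ⟨
        s ℕ.+ s ℕ.+ A          ≡⟨ ℕ.+-comm (s ℕ.+ s) A ⟩
        A ℕ.+ (s ℕ.+ s)        ≡⟨ cong (λ t → A ℕ.+ (s ℕ.+ t)) (ℕ.+-identityʳ s) ⟨
        A ℕ.+ 2 ℕ.* s          ∎
      a≡A : a p k₀ s ≡ A
      a≡A = %ℕ-unique (ℕ.suc P) {q = -1ℤ}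
        (trans (+a-+b≡+c-+d K0 (2 ℕ.* s) A (ℕ.suc P) K0+[p-1]≡A+2s)
               (cong (_+_ (+ A)) (sym (-1*i≡-i (+ ℕ.suc P)))))
        A<p-1

    dUrDagger≡dClosedForm-K0<s : ∀ {s} A → a p k₀ s ≡ A →
      A ℕ.+ (s ℕ.+ s) ≡ ℕ.suc (K0 ℕ.+ P) → K0 ℕ.< s →
      dUrDagger p k₀ k s ≡ dClosedForm (ℕ.suc p) K (ℕ.suc K0) s
    dUrDagger≡dClosedForm-K0<s {s} A a≡A A+2s≡ K0<s = begin
      dUrDagger p k₀ k s
        ≡⟨ dUrDagger-≡ p k₀ k s t₁≡ t₂≡ δ≡ ⟩
      F (K - + (s ℕ.+ 1)) + F (K - + t) + + 2 + + 1
        ≡⟨ regroup (F (K - + (s ℕ.+ 1))) (F (K - + t)) ⟩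
      F (K - + (s ℕ.+ 1)) + suc (F (K - + t)) + + 2
        ≡⟨ cong (λ y → F (K - + (s ℕ.+ 1)) + y + + 2) shift ⟨
      F (K - + (s ℕ.+ 1)) + F (K - + ℕ.suc K0 + + s) + + 2  ∎
      where
      open ≡-Reasoning
      t : ℕ
      t = A ℕ.+ s ℕ.+ 1 ℕ.+ 2
      regroup : ∀ x y → x + y + + 2 + + 1 ≡ x + (+ 1 + y) + + 2
      regroup = solve-∀
      shift : F (K - + ℕ.suc K0 + + s) ≡ suc (F (K - + t))
      shift = trans (cong F ([k-a]+b≡[k-c]+d K (k₀-1+[p+1]≡[A+s+3]+s s A A+2s≡)))
                    ([x+m]/ℕm≡suc[x/ℕm] (ℕ.suc p) (K - + t))
      a+s<p-1 : a p k₀ s ℕ.+ s ℕ.< ℕ.suc P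
      a+s<p-1 = subst (λ x → x ℕ.+ s ℕ.< ℕ.suc P) (sym a≡A) (A+s<p-1 s A A+2s≡ K0<s)
      res≡A+s : res p (+ (a p k₀ s ℕ.+ s)) ≡ A ℕ.+ s
      res≡A+s = trans (m<n⇒m%n≡m a+s<p-1) (cong (ℕ._+ s) a≡A)
      δ≡ : δ p k₀ s ≡ 1
      δ≡ = δ≡1 p k₀ s
        (subst (λ x → ℕ.suc P ℕ.≤ s ℕ.+ x) (sym res≡A+s) (p-1≤s+[A+s] s A A+2s≡))
      t₁≡ : t₁ p k₀ s ≡ s ℕ.+ 1
      t₁≡ = trans (t₁-a+s<p-1 p k₀ s a+s<p-1) (cong (s ℕ.+_) δ≡)
      t₂≡ : t₂ p k₀ s ≡ t
      t₂≡ = trans (t₂-a+s<p-1 p k₀ s a+s<p-1) (cong₂ (λ x e → x ℕ.+ s ℕ.+ e ℕ.+ 2) a≡A δ≡)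

    dUrDagger≡dClosedForm-s≤K0 : ∀ {s} A r → a p k₀ s ≡ A →
      A ℕ.+ (s ℕ.+ s) ≡ ℕ.suc (K0 ℕ.+ P) → s ℕ.+ r ≡ K0 → K0 ℕ.≤ P →
      dUrDagger p k₀ k s ≡ dClosedForm (ℕ.suc p) K (ℕ.suc K0) s
    dUrDagger≡dClosedForm-s≤K0 {s} A r a≡A A+2s≡ s+r≡K0 K0≤P = begin
      dUrDagger p k₀ k s
        ≡⟨ dUrDagger-≡ p k₀ k s t₁≡ t₂≡ δ≡ ⟩
      F (K - + (r ℕ.+ 0 ℕ.+ 1)) + F (K - + (s ℕ.+ 0 ℕ.+ 1)) + + 2 + + 0
        ≡⟨ cong₂ (λ x y → F x + F y + + 2 + + 0) (k-a≡[k-c]+d K [r+0+1]+s≡k₀-1)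
                                                  (cong (λ n → K - + (n ℕ.+ 1)) (ℕ.+-identityʳ s)) ⟩
      F (K - + ℕ.suc K0 + + s) + F (K - + (s ℕ.+ 1)) + + 2 + + 0
        ≡⟨ swap (F (K - + ℕ.suc K0 + + s)) (F (K - + (s ℕ.+ 1))) ⟩
      F (K - + (s ℕ.+ 1)) + F (K - + ℕ.suc K0 + + s) + + 2  ∎
      where
      open ≡-Reasoning
      swap : ∀ x y → x + y + + 2 + + 0 ≡ y + x + + 2
      swap = solve-∀
      p-1≤a+s : ℕ.suc P ℕ.≤ a p k₀ s ℕ.+ s
      p-1≤a+s = subst (ℕ.suc P ℕ.≤_)
        (trans (sym (A+s≡r+[p-1] s A A+2s≡ s+r≡K0)) (cong (ℕ._+ s) (sym a≡A))) (ℕ.m≤n+m (ℕ.suc P) r)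
      r<p-1 : r ℕ.< ℕ.suc P
      r<p-1 = ℕ.s≤s (ℕ.≤-trans (ℕ.m≤n+m r s) (subst (ℕ._≤ P) (sym s+r≡K0) K0≤P))
      res≡r : res p (+ (a p k₀ s ℕ.+ s)) ≡ r
      res≡r = begin
        (a p k₀ s ℕ.+ s) ℕ.% ℕ.suc P   ≡⟨ cong (λ x → (x ℕ.+ s) ℕ.% ℕ.suc P) a≡A ⟩
        (A ℕ.+ s) ℕ.% ℕ.suc P          ≡⟨ cong (ℕ._% ℕ.suc P) (A+s≡r+[p-1] s A A+2s≡ s+r≡K0) ⟩
        (r ℕ.+ ℕ.suc P) ℕ.% ℕ.suc P    ≡⟨ [m+n]%n≡m%n r (ℕ.suc P) ⟩
        r ℕ.% ℕ.suc P                  ≡⟨ m<n⇒m%n≡m r<p-1 ⟩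
        r                              ∎
      δ≡ : δ p k₀ s ≡ 0
      δ≡ = δ≡0 p k₀ s (subst (λ x → s ℕ.+ x ℕ.< ℕ.suc P) (sym res≡r)
                            (subst (ℕ._< ℕ.suc P) (sym s+r≡K0) (ℕ.s≤s K0≤P)))
      t₁≡ : t₁ p k₀ s ≡ r ℕ.+ 0 ℕ.+ 1
      t₁≡ = trans (t₁-p-1≤a+s p k₀ s p-1≤a+s) (cong₂ (λ x e → x ℕ.+ e ℕ.+ 1) res≡r δ≡)
      t₂≡ : t₂ p k₀ s ≡ s ℕ.+ 0 ℕ.+ 1
      t₂≡ = trans (t₂-p-1≤a+s p k₀ s p-1≤a+s) (cong (λ e → s ℕ.+ e ℕ.+ 1) δ≡)
      [r+0+1]+s≡k₀-1 : r ℕ.+ 0 ℕ.+ 1 ℕ.+ s ≡ ℕ.suc K0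
      [r+0+1]+s≡k₀-1 = begin
        r ℕ.+ 0 ℕ.+ 1 ℕ.+ s     ≡⟨ solveℕ (r ∷ s ∷ []) ⟩
        ℕ.suc (s ℕ.+ r)         ≡⟨ cong ℕ.suc s+r≡K0 ⟩
        ℕ.suc K0                ∎

    dUrDagger≡dClosedForm : ∀ {s} → K0 ℕ.≤ P → K0 ℕ.< s ℕ.+ s → s ℕ.+ s ℕ.≤ K0 ℕ.+ P →
      dUrDagger p k₀ k s ≡ dClosedForm (ℕ.suc p) K (ℕ.suc K0) s
    dUrDagger≡dClosedForm {s} K0≤P K0<2s 2s≤K0+P =
      [ dUrDagger≡dClosedForm-K0<s (a p k₀ s) refl a+2s≡
      , (λ s≤K0 → dUrDagger≡dClosedForm-s≤K0 (a p k₀ s) (K0 ℕ.∸ s) refl a+2s≡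
                                               (ℕ.m+[n∸m]≡n s≤K0) K0≤P)
      ]′ (ℕ.<-≤-connex K0 s)
      where
      a+2s≡ : a p k₀ s ℕ.+ (s ℕ.+ s) ≡ ℕ.suc (K0 ℕ.+ P)
      a+2s≡ = a+2s≡k₀+p-3 {s} K0<2s (ℕ.m≤n⇒m≤1+n 2s≤K0+P)

open import Data.Nat using (ℕ; _≤_; _∸_)
open import Data.Nat.Primality using (Prime)
open import Data.Integer using (+_; _-_)
open import Data.Integer.Divisibility using (_∣_)
open import Data.Nat.Base using (suc; s≤s; _+_; _<_)
open import Data.Nat.Properties
  using (<⇒≤; m≤n⇒m≤1+n; +-monoʳ-≤; n≤1+n; +-suc; module ≤-Reasoning)
open import Data.Integer.Base using (ℤ)

lemma3p17 : (p k₀ k : ℕ) → Prime p → 7 ≤ p → 2 ≤ k₀ → k₀ ≤ p →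
    2 ≤ k → (+ (p ∸ 1)) ∣ (+ k - + k₀) →
    OddDominant (InS p k₀) (dUrDagger p k₀ k)
lemma3p17 (suc (suc P)) (suc (suc K0)) k _ _ (s≤s (s≤s _)) (s≤s (s≤s K0≤P)) _ _ s s' s∈S s'∈S s<s' =
  subst₂ RegularPair (sym (closed s∈S)) (sym (closed s'∈S))
    (dClosedForm-regular (suc (suc (suc P))) K (suc K0) (<⇒≤ s<s')
      (s≤s (<⇒≤ (proj₁ (InS-bounds P K0 s∈S))))
      2s'+1<k₀-1+[p+1])
  where
  open ≤-Reasoning
  K : ℤ
  K = kbul (suc (suc P)) (suc (suc K0)) k
  2s'+1<k₀-1+[p+1] : suc (s' + s') < suc K0 + suc (suc (suc P))
  2s'+1<k₀-1+[p+1] = s≤s (begin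
    suc (s' + s')                ≤⟨ s≤s (proj₂ (InS-bounds P K0 s'∈S)) ⟩
    suc (K0 + P)                 ≡⟨ +-suc K0 P ⟨
    K0 + suc P                   ≤⟨ +-monoʳ-≤ K0 (m≤n⇒m≤1+n (n≤1+n (suc P))) ⟩
    K0 + suc (suc (suc P))       ∎)
  closed : ∀ {s} → InS (suc (suc P)) (suc (suc K0)) s →
           dUrDagger (suc (suc P)) (suc (suc K0)) k s ≡ dClosedForm (suc (suc (suc P))) K (suc K0) s
  closed s∈S =
    dUrDagger≡dClosedForm P K0 k K0≤P (proj₁ (InS-bounds P K0 s∈S)) (proj₂ (InS-bounds P K0 s∈S))
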